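{- For every negative odd integer $k$ and every positive integer $n$, $a(n,k)=c^{ -k}_{\text{even}}(n)$.
   Context: For an integer $k$, $A(n,k)$ is the set of compositions $(c_1,\ldots,c_t)$ of $n$ (finite sequences of positive integers summing to $n$) such that $c_{2i-1}>c_{2i}+k$ for every $i$ with $2i\le t$ (no condition on the last part if $t$ is odd), and $a(n,k)=|A(n,k)|$. For a nonnegative integer $j$, $C^{2j+1}_{\text{even}}(n)$ is the set of compositions of $n$ whose parts all lie in the set of positive even integers together with the odd integers $1,3,\ldots,2j+1$, and $c^{2j+1}_{\text{even}}(n)=|C^{2j+1}_{\text{even}}(n)|$. -}

module Defs where

open import Data.Nat using (ℕ; zero; suc; _+_; _*_; _∸_; _≤_; _≤?_)
open import Data.Nat.Divisibility using (_∣_; _∣?_)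
open import Data.Integer as ℤ using (ℤ; +_)
open import Data.List using (List; []; _∷_; [_]; map; concatMap; upTo; filter; length)
open import Data.Product using (_×_; _,_)
open import Data.Sum using (_⊎_)
open import Data.Unit using (⊤)
open import Relation.Nullary using (¬_; Dec; yes; no)
open import Relation.Nullary.Decidable using (_×-dec_; _⊎-dec_; ¬?)
open import Relation.Binary.PropositionalEquality using (_≢_)

-- The first argument is fuel (≥ n).
comps : ℕ → ℕ → List (List ℕ)
comps _       zero    = [ [] ]
comps zero    (suc n) = []
comps (suc f) (suc n) =
  concatMap (λ p → map (suc p ∷_) (comps f (n ∸ p))) (upTo (suc n))

compositions : ℕ → List (List ℕ)
compositions n = comps n n

PairCond : ℤ → List ℕ → Set
PairCond k []              = ⊤
PairCond k (x ∷ [])        = ⊤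
PairCond k (x ∷ y ∷ rest)  = ((+ y) ℤ.+ k ℤ.< + x) × PairCond k rest

pairCond? : (k : ℤ) → (c : List ℕ) → Dec (PairCond k c)
pairCond? k []             = yes _
pairCond? k (x ∷ [])       = yes _
pairCond? k (x ∷ y ∷ rest) = ((+ y ℤ.+ k) ℤ.<? (+ x)) ×-dec pairCond? k rest

a : ℕ → ℤ → ℕ
a n k = length (filter (pairCond? k) (compositions n))

Allowed : ℕ → ℕ → Set
Allowed j p = (p ≢ 0 × 2 ∣ p) ⊎ (¬ (2 ∣ p) × p ≤ 2 * j + 1)

allowed? : (j p : ℕ) → Dec (Allowed j p)
allowed? j zero    = no λ { (Data.Sum.inj₁ (h , _)) → h Relation.Binary.PropositionalEquality.refl
                          ; (Data.Sum.inj₂ (h , _)) → h (Data.Nat.Divisibility.divides 0 Relation.Binary.PropositionalEquality.refl) }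
allowed? j (suc p) = ((yes (λ ())) ×-dec (2 ∣? suc p)) ⊎-dec (¬? (2 ∣? suc p) ×-dec (suc p ≤? 2 * j + 1))

AllParts : ℕ → List ℕ → Set
AllParts j []       = ⊤
AllParts j (x ∷ xs) = Allowed j x × AllParts j xs

allParts? : (j : ℕ) → (c : List ℕ) → Dec (AllParts j c)
allParts? j []       = yes _
allParts? j (x ∷ xs) = allowed? j x ×-dec allParts? j xs

cEven : ℕ → ℕ → ℕ
cEven j n = length (filter (allParts? j) (compositions n))

{-# OPTIONS --safe #-}
-- Let P(x) count the pairs (c₁, c₂) of positive parts with c₂ ≤ c₁ + 2j, i.e. the
-- pairs allowed to open a composition in A(n, -(2j+1)), and let Q(x) count the parts
-- allowed in C^{2j+1}_even. Peeling leading pairs off a composition gives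
-- A = 1/(1-x) + P·A, and peeling the first part gives C = 1 + Q·C. For m ≥ 2 the
-- pairs of sum m exceed those of sum m-1 by exactly Q_m (the new pairs are governed by
-- the parity of m - 2j), which amounts to Q + x·P = x + P, i.e.
-- 1 - Q = (1 - x)(1 - P). Hence A = 1 + Q·A as well, and this recurrence has a unique
-- solution. Power series are sequences ℕ → ℕ under convolution, and every identity is
-- arranged so that no subtraction occurs.
module Submission where

open import Defs
open import Data.Integer as ℤ using (ℤ; -[1+_])
import Data.Integer.Properties as ℤₚ
open import Algebra.Bundles using (AbelianGroup)
open import Algebra.Properties.Group (AbelianGroup.group ℤₚ.+-0-abelianGroup) using (//-rightDividesˡ; //-rightDividesʳ)
open import Data.List using (List; []; _∷_; _++_; map; concatMap; applyUpTo; upTo; filter; length)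
open import Data.List.Properties using (filter-++; length-++; filter-≐; filter-none; concatMap-cong)
open import Data.List.Relation.Unary.All using (universal)
open import Data.Bool.Base using (true; false)
open import Data.Empty using (⊥-elim)
open import Data.Nat.Base
open import Data.Nat.Properties
open import Algebra.Properties.CommutativeSemigroup +-commutativeSemigroup using (interchange)
open import Data.Nat.Divisibility using (_∣_; _∣?_; ∣m+n∣m⇒∣n; ∣1⇒≡1; m∣m*n)
open import Data.Nat.Induction using (<-rec)
open import Data.Nat.ListAction using (sum)
open import Data.Nat.Tactic.RingSolver using (solve-∀)
open import Data.Product using (_,_; proj₁; proj₂; ∃-syntax)
open import Data.Sum using (_⊎_; inj₁; inj₂; [_,_])
open import Function using (_∘_; _⇔_; mk⇔; Equivalence)
open import Level using (Level)
open import Relation.Nullary using (¬_; Dec; yes; no; does; contradiction)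
open import Relation.Nullary.Decidable using (_×-dec_)
open import Relation.Unary using (Pred; Decidable)
open import Relation.Binary.PropositionalEquality
  using (_≡_; _≢_; _≗_; refl; sym; trans; cong; cong₂; subst; module ≡-Reasoning)

open ≡-Reasoning

private
  variable
    α β ℓ : Level
    S : Set α
    T : Set β
    X Y : Set ℓ

𝟙 : Dec X → ℕ
𝟙 (yes _) = 1
𝟙 (no _)  = 0

𝟙-yes : X → (x? : Dec X) → 𝟙 x? ≡ 1
𝟙-yes x (yes _) = refl
𝟙-yes x (no ¬x) = contradiction x ¬x

𝟙-no : ¬ X → (x? : Dec X) → 𝟙 x? ≡ 0
𝟙-no ¬x (yes x) = contradiction x ¬x
𝟙-no ¬x (no _)  = refl

𝟙-⇔ : X ⇔ Y → (x? : Dec X) (y? : Dec Y) → 𝟙 x? ≡ 𝟙 y?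
𝟙-⇔ X⇔Y (yes x) y? = sym (𝟙-yes (Equivalence.to X⇔Y x) y?)
𝟙-⇔ X⇔Y (no ¬x) y? = sym (𝟙-no (¬x ∘ Equivalence.from X⇔Y) y?)

𝟙-≤?-suc : ∀ m n → 𝟙 (m ≤? suc n) ≡ 𝟙 (m ≤? n) + 𝟙 (m ≟ suc n)
𝟙-≤?-suc m n with m ≤? n | m ≟ suc n
... | yes m≤n | no  _     = 𝟙-yes (m≤n⇒m≤1+n m≤n) (m ≤? suc n)
... | yes m≤n | yes refl  = contradiction m≤n 1+n≰n
... | no  _   | yes refl  = 𝟙-yes ≤-refl (suc n ≤? suc n)
... | no  m≰n | no  m≢1+n = 𝟙-no m≰1+n (m ≤? suc n)
  where
  m≰1+n : ¬ m ≤ suc n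
  m≰1+n m≤1+n = [ m≰n ∘ s≤s⁻¹ , m≢1+n ] (m≤n⇒m<n∨m≡n m≤1+n)

∑< : ℕ → (ℕ → ℕ) → ℕ
∑< zero    f = 0
∑< (suc n) f = f 0 + ∑< n (f ∘ suc)

syntax ∑< n (λ i → e) = ∑[ i < n ] e

∑-cong : ∀ n {f g} → f ≗ g → ∑< n f ≡ ∑< n g
∑-cong zero    f≗g = refl
∑-cong (suc n) f≗g = cong₂ _+_ (f≗g 0) (∑-cong n (f≗g ∘ suc))

∑-+ : ∀ n f g → ∑[ i < n ] (f i + g i) ≡ ∑< n f + ∑< n g
∑-+ zero    f g = refl
∑-+ (suc n) f g = begin
  (f 0 + g 0) + ∑[ i < n ] (f (suc i) + g (suc i))
    ≡⟨ cong ((f 0 + g 0) +_) (∑-+ n (f ∘ suc) (g ∘ suc)) ⟩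
  (f 0 + g 0) + (∑< n (f ∘ suc) + ∑< n (g ∘ suc))
    ≡⟨ interchange (f 0) (g 0) _ _ ⟩
  (f 0 + ∑< n (f ∘ suc)) + (g 0 + ∑< n (g ∘ suc))
    ∎

∑-zero : ∀ n {f} → (∀ i → f i ≡ 0) → ∑< n f ≡ 0
∑-zero zero    f≡0 = refl
∑-zero (suc n) f≡0 = cong₂ _+_ (f≡0 0) (∑-zero n (f≡0 ∘ suc))

∑-𝟙-≟ : ∀ {n b} → b < n → ∑[ i < n ] 𝟙 (i ≟ b) ≡ 1
∑-𝟙-≟ {suc n} {zero}  _       = cong suc (∑-zero n λ _ → refl)
∑-𝟙-≟ {suc n} {suc b} b+1<1+n = begin
  ∑[ i < n ] 𝟙 (suc i ≟ suc b)  ≡⟨ ∑-cong n (λ i → 𝟙-⇔ (mk⇔ suc-injective (cong suc)) _ _) ⟩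
  ∑[ i < n ] 𝟙 (i ≟ b)          ≡⟨ ∑-𝟙-≟ (s≤s⁻¹ b+1<1+n) ⟩
  1                             ∎

antidiagonal : (ℕ → ℕ → ℕ) → ℕ → ℕ
antidiagonal g n = ∑[ p < suc n ] g p (n ∸ p)

infixl 7 _⋆_

_⋆_ : (ℕ → ℕ) → (ℕ → ℕ) → ℕ → ℕ
f ⋆ g = antidiagonal (λ p q → f p * g q)

δ₀ : ℕ → ℕ
δ₀ zero    = 1
δ₀ (suc _) = 0

shift : (ℕ → ℕ) → ℕ → ℕ
shift f zero    = 0
shift f (suc n) = f n

shift-cong : ∀ {f g} → f ≗ g → shift f ≗ shift g
shift-cong f≗g zero    = refl
shift-cong f≗g (suc n) = f≗g n

⋆-congˡ : ∀ {f g} h → f ≗ g → f ⋆ h ≗ g ⋆ h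
⋆-congˡ h f≗g n = ∑-cong (suc n) (λ p → cong (_* h (n ∸ p)) (f≗g p))

⋆-distribʳ-+ : ∀ f g h n → ((λ i → f i + g i) ⋆ h) n ≡ (f ⋆ h) n + (g ⋆ h) n
⋆-distribʳ-+ f g h n = trans
  (∑-cong (suc n) (λ p → *-distribʳ-+ (h (n ∸ p)) (f p) (g p)))
  (∑-+ (suc n) (λ p → f p * h (n ∸ p)) (λ p → g p * h (n ∸ p)))

δ₀-⋆ : ∀ g → δ₀ ⋆ g ≗ g
δ₀-⋆ g n = trans (cong₂ _+_ (+-identityʳ (g n)) (∑-zero n (λ _ → refl))) (+-identityʳ (g n))

shift-⋆ : ∀ f g → shift f ⋆ g ≗ shift (f ⋆ g)
shift-⋆ f g zero    = refl
shift-⋆ f g (suc n) = refl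

antidiagonal-δ₀ : ∀ n → antidiagonal (λ _ → δ₀) n ≡ 1
antidiagonal-δ₀ zero    = refl
antidiagonal-δ₀ (suc n) = antidiagonal-δ₀ n

antidiagonal-shift : ∀ g → antidiagonal (λ p → shift (g p)) ≗ shift (antidiagonal g)
antidiagonal-shift g zero    = refl
antidiagonal-shift g (suc n) = trans (cong (g 0 n +_) (antidiagonal-shift (g ∘ suc) n)) (peel n)
  where
  peel : ∀ n → g 0 n + shift (antidiagonal (g ∘ suc)) n ≡ antidiagonal g n
  peel zero    = refl
  peel (suc n) = refl

antidiagonal-⋆ : ∀ g h → antidiagonal (λ p → g p ⋆ h) ≗ antidiagonal g ⋆ h
antidiagonal-⋆ g h zero = cong (_+ 0)
  (trans (+-identityʳ (g 0 0 * h 0)) (cong (_* h 0) (sym (+-identityʳ (g 0 0)))))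
antidiagonal-⋆ g h (suc n) = begin
  g 0 0 * h (suc n) + (g 0 ∘ suc ⋆ h) n + antidiagonal (λ p → g (suc p) ⋆ h) n
    ≡⟨ cong (g 0 0 * h (suc n) + (g 0 ∘ suc ⋆ h) n +_) (antidiagonal-⋆ (g ∘ suc) h n) ⟩
  g 0 0 * h (suc n) + (g 0 ∘ suc ⋆ h) n + (antidiagonal (g ∘ suc) ⋆ h) n
    ≡⟨ +-assoc (g 0 0 * h (suc n)) _ _ ⟩
  g 0 0 * h (suc n) + ((g 0 ∘ suc ⋆ h) n + (antidiagonal (g ∘ suc) ⋆ h) n)
    ≡⟨ cong₂ _+_ (cong (_* h (suc n)) (sym (+-identityʳ (g 0 0))))
                 (sym (⋆-distribʳ-+ (g 0 ∘ suc) (antidiagonal (g ∘ suc)) h n)) ⟩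
  (antidiagonal g ⋆ h) (suc n)
    ∎

⋆-congʳ-< : ∀ {q x y} n → q 0 ≡ 0 → (∀ {m} → m < n → x m ≡ y m) → (q ⋆ x) n ≡ (q ⋆ y) n
⋆-congʳ-< {q} zero    q₀≡0 _ rewrite q₀≡0 = refl
⋆-congʳ-< {q} (suc n) q₀≡0 x≡y rewrite q₀≡0 =
  ∑-cong (suc n) (λ i → cong (q (suc i) *_) (x≡y (s≤s (m∸n≤m n i))))

⋆-fixpoint-unique : ∀ {q x y} → q 0 ≡ 0 →
  (∀ n → x n ≡ δ₀ n + (q ⋆ x) n) → (∀ n → y n ≡ δ₀ n + (q ⋆ y) n) → x ≗ y
⋆-fixpoint-unique {q} {x} {y} q₀≡0 x-fix y-fix = <-rec _ step
  where
  step : ∀ n → (∀ {m} → m < n → x m ≡ y m) → x n ≡ y n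
  step n x≡y = begin
    x n                ≡⟨ x-fix n ⟩
    δ₀ n + (q ⋆ x) n   ≡⟨ cong (δ₀ n +_) (⋆-congʳ-< {q} n q₀≡0 x≡y) ⟩
    δ₀ n + (q ⋆ y) n   ≡⟨ y-fix n ⟨
    y n                ∎

count : {P : Pred S ℓ} → Decidable P → List S → ℕ
count P? = length ∘ filter P?

count-++ : {P : Pred S ℓ} (P? : Decidable P) (xs ys : List S) →
  count P? (xs ++ ys) ≡ count P? xs + count P? ys
count-++ P? xs ys = trans (cong length (filter-++ P? xs ys)) (length-++ (filter P? xs))

count-concatMap : {P : Pred T ℓ} (P? : Decidable P) (f : S → List T) (xs : List S) →
  count P? (concatMap f xs) ≡ sum (map (count P? ∘ f) xs)
count-concatMap P? f []       = refl
count-concatMap P? f (x ∷ xs) =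
  trans (count-++ P? (f x) (concatMap f xs)) (cong (count P? (f x) +_) (count-concatMap P? f xs))

count-map : {P : Pred T ℓ} (P? : Decidable P) (f : S → T) (xs : List S) →
  count P? (map f xs) ≡ count (P? ∘ f) xs
count-map P? f []       = refl
count-map P? f (x ∷ xs) with does (P? (f x))
... | true  = cong suc (count-map P? f xs)
... | false = count-map P? f xs

count-×-dec : {P : Pred S ℓ} (x? : Dec X) (P? : Decidable P) (xs : List S) →
  count (λ y → x? ×-dec P? y) xs ≡ 𝟙 x? * count P? xs
count-×-dec (yes x) P? xs = trans
  (cong length (filter-≐ _ P? (proj₂ , (x ,_)) xs)) (sym (+-identityʳ _))
count-×-dec (no ¬x) P? xs = cong length (filter-none _ (universal (λ _ → ¬x ∘ proj₁) xs))

sum-map-applyUpTo : ∀ (g f : ℕ → ℕ) n → sum (map g (applyUpTo f n)) ≡ ∑[ i < n ] g (f i)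
sum-map-applyUpTo g f zero    = refl
sum-map-applyUpTo g f (suc n) = cong (g (f 0) +_) (sum-map-applyUpTo g (f ∘ suc) n)

comps-fuel : ∀ {f g} n → n ≤ f → n ≤ g → comps f n ≡ comps g n
comps-fuel zero    _ _ = refl
comps-fuel {suc f} {suc g} (suc n) 1+n≤1+f 1+n≤1+g = concatMap-cong
  (λ p → cong (map (suc p ∷_)) (comps-fuel (n ∸ p) (∸-≤ p 1+n≤1+f) (∸-≤ p 1+n≤1+g))) (upTo (suc n))
  where
  ∸-≤ : ∀ p {m} → suc n ≤ suc m → n ∸ p ≤ m
  ∸-≤ p 1+n≤1+m = ≤-trans (m∸n≤m n p) (s≤s⁻¹ 1+n≤1+m)

count-compositions-suc : {P : Pred (List ℕ) ℓ} (P? : Decidable P) (m : ℕ) →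
  count P? (compositions (suc m)) ≡
  ∑[ p < suc m ] count (λ xs → P? (suc p ∷ xs)) (compositions (m ∸ p))
count-compositions-suc P? m = begin
  count P? (concatMap (λ p → map (suc p ∷_) (comps m (m ∸ p))) (upTo (suc m)))
    ≡⟨ count-concatMap P? (λ p → map (suc p ∷_) (comps m (m ∸ p))) (upTo (suc m)) ⟩
  sum (map (λ p → count P? (map (suc p ∷_) (comps m (m ∸ p)))) (upTo (suc m)))
    ≡⟨ sum-map-applyUpTo _ (λ p → p) (suc m) ⟩
  ∑[ p < suc m ] count P? (map (suc p ∷_) (comps m (m ∸ p)))
    ≡⟨ ∑-cong (suc m) (λ p → count-map P? (suc p ∷_) (comps m (m ∸ p))) ⟩
  ∑[ p < suc m ] count (λ xs → P? (suc p ∷ xs)) (comps m (m ∸ p))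
    ≡⟨ ∑-cong (suc m) (λ p →
         cong (count (λ xs → P? (suc p ∷ xs))) (comps-fuel (m ∸ p) (m∸n≤m m p) ≤-refl)) ⟩
  ∑[ p < suc m ] count (λ xs → P? (suc p ∷ xs)) (compositions (m ∸ p))
    ∎

+y+-[1+m]<+x⇔y≤x+m : ∀ x y m → (ℤ.+ y ℤ.+ -[1+ m ]) ℤ.< ℤ.+ x ⇔ y ≤ x + m
+y+-[1+m]<+x⇔y≤x+m x y m = mk⇔ to from
  where
  to : (ℤ.+ y ℤ.+ -[1+ m ]) ℤ.< ℤ.+ x → y ≤ x + m
  to lt = s≤s⁻¹ (subst (suc y ≤_) (+-suc x m) (ℤₚ.drop‿+<+ y<x+1+m))
    where
    y<x+1+m : ℤ.+ y ℤ.< ℤ.+ (x + suc m)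
    y<x+1+m = subst (ℤ._< ℤ.+ (x + suc m)) (//-rightDividesˡ (ℤ.+ suc m) (ℤ.+ y))
                    (ℤₚ.+-monoˡ-< (ℤ.+ suc m) lt)
  from : y ≤ x + m → (ℤ.+ y ℤ.+ -[1+ m ]) ℤ.< ℤ.+ x
  from y≤x+m = subst (ℤ.+ y ℤ.+ -[1+ m ] ℤ.<_) (//-rightDividesʳ (ℤ.+ suc m) (ℤ.+ x))
                     (ℤₚ.+-monoˡ-< -[1+ m ] (ℤ.+<+ (subst (suc y ≤_) (sym (+-suc x m)) (s≤s y≤x+m))))

even-or-odd : ∀ n → (∃[ b ] n ≡ 2 * b) ⊎ (∃[ b ] n ≡ suc (2 * b))
even-or-odd zero = inj₁ (0 , refl)
even-or-odd (suc n) with even-or-odd n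
... | inj₁ (b , refl) = inj₂ (b , refl)
... | inj₂ (b , refl) = inj₁ (suc b , cong suc (sym (+-suc b (b + 0))))

2∤1+2n : ∀ n → ¬ 2 ∣ suc (2 * n)
2∤1+2n n 2∣1+2n = contradiction (∣1⇒≡1 (∣m+n∣m⇒∣n 2∣2n+1 (m∣m*n n))) λ ()
  where
  2∣2n+1 : 2 ∣ 2 * n + 1
  2∣2n+1 = subst (2 ∣_) (+-comm 1 (2 * n)) 2∣1+2n

∸≡suc⇔ : ∀ t p c → t ∸ p ≡ suc (p + c) ⇔ t ≡ c + suc (2 * p)
∸≡suc⇔ t p c = mk⇔ to from
  where
  identity : ∀ p c → p + suc (p + c) ≡ c + suc (2 * p)
  identity = solve-∀
  to : t ∸ p ≡ suc (p + c) → t ≡ c + suc (2 * p)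
  to eq = begin
    t                  ≡⟨ m+[n∸m]≡n p≤t ⟨
    p + (t ∸ p)        ≡⟨ cong (p +_) eq ⟩
    p + suc (p + c)    ≡⟨ identity p c ⟩
    c + suc (2 * p)    ∎
    where
    p≤t : p ≤ t
    p≤t = <⇒≤ (m∸n≢0⇒n<m λ t∸p≡0 → 0≢1+n (trans (sym t∸p≡0) eq))
  from : t ≡ c + suc (2 * p) → t ∸ p ≡ suc (p + c)
  from refl = trans (cong (_∸ p) (sym (identity p c))) (m+n∸m≡n p (suc (p + c)))

module _ (j : ℕ) where

  k : ℤ
  k = -[1+ 2 * j ]

  A C : ℕ → ℕ
  A n = a n k
  C n = cEven j n

  -- Parts are indexed by their predecessors, as in the enumeration of compositions:
  -- pairFits p q = 1 iff the parts 1+p, 1+q may form a pair of a composition in A.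
  pairFits : ℕ → ℕ → ℕ
  pairFits p q = 𝟙 (q ≤? p + 2 * j)

  pairs : ℕ → ℕ
  pairs = antidiagonal pairFits

  pairsOfSum : ℕ → ℕ
  pairsOfSum = shift (shift pairs)

  allowedPart : ℕ → ℕ
  allowedPart m = 𝟙 (allowed? j m)

  oddExcess : ℕ → ℕ
  oddExcess t = ∑[ p < suc t ] 𝟙 (t ≟ 2 * j + suc (2 * p))

  count-after-first-part : ∀ p r →
    count (λ xs → pairCond? k (suc p ∷ xs)) (compositions r) ≡ δ₀ r + shift (pairFits p ⋆ A) r
  count-after-first-part p zero    = refl
  count-after-first-part p (suc r) = begin
    count (λ xs → pairCond? k (suc p ∷ xs)) (compositions (suc r))
      ≡⟨ count-compositions-suc (λ xs → pairCond? k (suc p ∷ xs)) r ⟩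
    ∑[ q < suc r ] count (λ xs → pairCond? k (suc p ∷ suc q ∷ xs)) (compositions (r ∸ q))
      ≡⟨ ∑-cong (suc r) (λ q → count-×-dec (fits? q) (pairCond? k) (compositions (r ∸ q))) ⟩
    ∑[ q < suc r ] (𝟙 (fits? q) * A (r ∸ q))
      ≡⟨ ∑-cong (suc r) (λ q → cong (_* A (r ∸ q)) (𝟙-⇔ (fits⇔ q) (fits? q) (q ≤? p + 2 * j))) ⟩
    (pairFits p ⋆ A) r
      ∎
    where
    fits? : ∀ q → Dec ((ℤ.+ suc q ℤ.+ k) ℤ.< ℤ.+ suc p)
    fits? q = (ℤ.+ suc q ℤ.+ k) ℤ.<? ℤ.+ suc p
    fits⇔ : ∀ q → (ℤ.+ suc q ℤ.+ k) ℤ.< ℤ.+ suc p ⇔ q ≤ p + 2 * j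
    fits⇔ q = let open Equivalence (+y+-[1+m]<+x⇔y≤x+m (suc p) (suc q) (2 * j)) in
      mk⇔ (s≤s⁻¹ ∘ to) (from ∘ s≤s)

  A-≡-1+pairsOfSum⋆A : ∀ n → A n ≡ 1 + (pairsOfSum ⋆ A) n
  A-≡-1+pairsOfSum⋆A zero    = refl
  A-≡-1+pairsOfSum⋆A (suc m) = begin
    A (suc m)
      ≡⟨ count-compositions-suc (pairCond? k) m ⟩
    antidiagonal (λ p r → count (λ xs → pairCond? k (suc p ∷ xs)) (compositions r)) m
      ≡⟨ ∑-cong (suc m) (λ p → count-after-first-part p (m ∸ p)) ⟩
    antidiagonal (λ p r → δ₀ r + shift (pairFits p ⋆ A) r) m
      ≡⟨ ∑-+ (suc m) (λ p → δ₀ (m ∸ p)) (λ p → shift (pairFits p ⋆ A) (m ∸ p)) ⟩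
    antidiagonal (λ _ → δ₀) m + antidiagonal (λ p → shift (pairFits p ⋆ A)) m
      ≡⟨ cong₂ _+_ (antidiagonal-δ₀ m) (antidiagonal-shift (λ p → pairFits p ⋆ A) m) ⟩
    1 + shift (antidiagonal (λ p → pairFits p ⋆ A)) m
      ≡⟨ cong (1 +_) (shift-cong (antidiagonal-⋆ pairFits A) m) ⟩
    1 + shift (pairs ⋆ A) m
      ≡⟨ cong (1 +_) (shift-⋆ pairs A m) ⟨
    1 + (pairsOfSum ⋆ A) (suc m)
      ∎

  allowed-≤ : ∀ {m} → m ≢ 0 → m ≤ suc (2 * j + 1) → Allowed j m
  allowed-≤ {m} m≢0 m≤2j+2 with 2 ∣? m
  ... | yes 2∣m = inj₁ (m≢0 , 2∣m)
  ... | no  2∤m = inj₂ (2∤m , [ s≤s⁻¹ , ⊥-elim ∘ m≢2j+2 ] (m≤n⇒m<n∨m≡n m≤2j+2))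
    where
    double-suc : ∀ n → 2 * suc n ≡ suc (2 * n + 1)
    double-suc = solve-∀
    2∣2j+2 : 2 ∣ suc (2 * j + 1)
    2∣2j+2 = subst (2 ∣_) (double-suc j) (m∣m*n (suc j))
    m≢2j+2 : m ≢ suc (2 * j + 1)
    m≢2j+2 m≡2j+2 = 2∤m (subst (2 ∣_) (sym m≡2j+2) 2∣2j+2)

  allowed-odd-excess : ∀ b → Allowed j (3 + (2 * j + suc (2 * b)))
  allowed-odd-excess b = inj₁ ((λ ()) , subst (2 ∣_) (identity j b) (m∣m*n (j + b + 2)))
    where
    identity : ∀ j b → 2 * (j + b + 2) ≡ 3 + (2 * j + suc (2 * b))
    identity = solve-∀

  not-allowed-even-excess : ∀ b → ¬ Allowed j (3 + (2 * j + 2 * b))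
  not-allowed-even-excess b (inj₁ (_ , 2∣)) = 2∤1+2n (suc (j + b)) (subst (2 ∣_) (identity j b) 2∣)
    where
    identity : ∀ j b → 3 + (2 * j + 2 * b) ≡ suc (2 * suc (j + b))
    identity = solve-∀
  not-allowed-even-excess b (inj₂ (_ , ≤2j+1)) =
    m+1+n≰m (2 * j + 1) (subst (_≤ 2 * j + 1) (identity j b) ≤2j+1)
    where
    identity : ∀ j b → 3 + (2 * j + 2 * b) ≡ 2 * j + 1 + suc (suc (2 * b))
    identity = solve-∀

  oddExcess-odd : ∀ b → oddExcess (2 * j + suc (2 * b)) ≡ 1
  oddExcess-odd b = trans
    (∑-cong (suc t) (λ p → 𝟙-⇔ (t≡⇔ p) (t ≟ 2 * j + suc (2 * p)) (p ≟ b)))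
    (∑-𝟙-≟ (s≤s b≤t))
    where
    t = 2 * j + suc (2 * b)
    t≡⇔ : ∀ p → t ≡ 2 * j + suc (2 * p) ⇔ p ≡ b
    t≡⇔ p = mk⇔ (λ eq → sym (*-cancelˡ-≡ b p 2 (suc-injective (+-cancelˡ-≡ (2 * j) _ _ eq))))
                (λ { refl → refl })
    b≤t : b ≤ t
    b≤t = ≤-trans (m≤m+n b (b + 0)) (≤-trans (n≤1+n (2 * b)) (m≤n+m _ (2 * j)))

  oddExcess-even : ∀ b → oddExcess (2 * j + 2 * b) ≡ 0
  oddExcess-even b = ∑-zero (suc t) (λ p → 𝟙-no (t≢ p) (t ≟ 2 * j + suc (2 * p)))
    where
    t = 2 * j + 2 * b
    t≢ : ∀ p → t ≢ 2 * j + suc (2 * p)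
    t≢ p eq = 2∤1+2n p (subst (2 ∣_) (+-cancelˡ-≡ (2 * j) _ _ eq) (m∣m*n b))

  allowedPart-excess : ∀ d → allowedPart (3 + (2 * j + d)) ≡ oddExcess (2 * j + d)
  allowedPart-excess d with even-or-odd d
  ... | inj₁ (b , refl) = trans
    (𝟙-no (not-allowed-even-excess b) (allowed? j (3 + (2 * j + 2 * b)))) (sym (oddExcess-even b))
  ... | inj₂ (b , refl) = trans
    (𝟙-yes (allowed-odd-excess b) (allowed? j (3 + (2 * j + suc (2 * b))))) (sym (oddExcess-odd b))

  allowedPart-suc³ : ∀ t → allowedPart (3 + t) ≡ 𝟙 (suc t ≤? 2 * j) + oddExcess t
  allowedPart-suc³ t with suc t ≤? 2 * j
  ... | yes 1+t≤2j = trans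
    (𝟙-yes (allowed-≤ (λ ()) 3+t≤2j+2) (allowed? j (3 + t)))
    (cong suc (sym (∑-zero (suc t) (λ p → 𝟙-no (t≢ p) (t ≟ 2 * j + suc (2 * p))))))
    where
    3+t≤2j+2 : 3 + t ≤ suc (2 * j + 1)
    3+t≤2j+2 = s≤s (subst (2 + t ≤_) (+-comm 1 (2 * j)) (s≤s 1+t≤2j))
    t≢ : ∀ p → t ≢ 2 * j + suc (2 * p)
    t≢ p t≡ = <⇒≱ 1+t≤2j (subst (2 * j ≤_) (sym t≡) (m≤m+n (2 * j) _))
  ... | no  1+t≰2j = subst (λ t → allowedPart (3 + t) ≡ oddExcess t) (m+[n∸m]≡n 2j≤t)
    (allowedPart-excess (t ∸ 2 * j))
    where
    2j≤t : 2 * j ≤ t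
    2j≤t = s≤s⁻¹ (≰⇒> 1+t≰2j)

  pairs-suc : ∀ t → pairs (suc t) ≡ 𝟙 (suc t ≤? 2 * j) + (pairs t + oddExcess t)
  pairs-suc t = cong (𝟙 (suc t ≤? 2 * j) +_) (begin
    ∑[ p < suc t ] pairFits (suc p) (t ∸ p)
      ≡⟨ ∑-cong (suc t) (λ p → 𝟙-≤?-suc (t ∸ p) (p + 2 * j)) ⟩
    ∑[ p < suc t ] (pairFits p (t ∸ p) + 𝟙 (t ∸ p ≟ suc (p + 2 * j)))
      ≡⟨ ∑-+ (suc t) (λ p → pairFits p (t ∸ p)) (λ p → 𝟙 (t ∸ p ≟ suc (p + 2 * j))) ⟩
    pairs t + ∑[ p < suc t ] 𝟙 (t ∸ p ≟ suc (p + 2 * j))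
      ≡⟨ cong (pairs t +_) (∑-cong (suc t) (λ p →
           𝟙-⇔ (∸≡suc⇔ t p (2 * j)) (t ∸ p ≟ suc (p + 2 * j)) (t ≟ 2 * j + suc (2 * p)))) ⟩
    pairs t + oddExcess t
      ∎)

  allowedPart+pairs : ∀ t → allowedPart (3 + t) + pairs t ≡ pairs (suc t)
  allowedPart+pairs t = begin
    allowedPart (3 + t) + pairs t    ≡⟨ cong (_+ pairs t) (allowedPart-suc³ t) ⟩
    small + oddExcess t + pairs t    ≡⟨ +-assoc small _ _ ⟩
    small + (oddExcess t + pairs t)  ≡⟨ cong (small +_) (+-comm (oddExcess t) _) ⟩
    small + (pairs t + oddExcess t)  ≡⟨ pairs-suc t ⟨
    pairs (suc t)                    ∎
    where
    small = 𝟙 (suc t ≤? 2 * j)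

  allowedPart+shift-pairsOfSum : ∀ n → allowedPart n + shift pairsOfSum n ≡ shift δ₀ n + pairsOfSum n
  allowedPart+shift-pairsOfSum 0 = refl
  allowedPart+shift-pairsOfSum 1 = cong (_+ 0) (𝟙-yes (allowed-≤ (λ ()) (s≤s z≤n)) (allowed? j 1))
  allowedPart+shift-pairsOfSum 2 = cong (_+ 0) (trans
    (𝟙-yes (allowed-≤ (λ ()) (s≤s (m≤n+m 1 (2 * j)))) (allowed? j 2))
    (sym (𝟙-yes z≤n (0 ≤? 2 * j))))
  allowedPart+shift-pairsOfSum (suc (suc (suc t))) = allowedPart+pairs t

  A-fixpoint : ∀ n → A n ≡ δ₀ n + (allowedPart ⋆ A) n
  A-fixpoint zero    = refl
  A-fixpoint (suc m) = +-cancelʳ-≡ ((pairsOfSum ⋆ A) m) _ _ (begin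
    A (suc m) + (pairsOfSum ⋆ A) m
      ≡⟨ cong (_+ (pairsOfSum ⋆ A) m) (A-≡-1+pairsOfSum⋆A (suc m)) ⟩
    suc ((pairsOfSum ⋆ A) (suc m) + (pairsOfSum ⋆ A) m)
      ≡⟨ cong suc (+-comm ((pairsOfSum ⋆ A) (suc m)) _) ⟩
    suc ((pairsOfSum ⋆ A) m) + (pairsOfSum ⋆ A) (suc m)
      ≡⟨ cong (_+ (pairsOfSum ⋆ A) (suc m)) (A-≡-1+pairsOfSum⋆A m) ⟨
    A m + (pairsOfSum ⋆ A) (suc m)
      ≡⟨ cong (_+ (pairsOfSum ⋆ A) (suc m)) (δ₀-⋆ A m) ⟨
    (shift δ₀ ⋆ A) (suc m) + (pairsOfSum ⋆ A) (suc m)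
      ≡⟨ ⋆-distribʳ-+ (shift δ₀) pairsOfSum A (suc m) ⟨
    ((λ i → shift δ₀ i + pairsOfSum i) ⋆ A) (suc m)
      ≡⟨ ⋆-congˡ A allowedPart+shift-pairsOfSum (suc m) ⟨
    ((λ i → allowedPart i + shift pairsOfSum i) ⋆ A) (suc m)
      ≡⟨ ⋆-distribʳ-+ allowedPart (shift pairsOfSum) A (suc m) ⟩
    (allowedPart ⋆ A) (suc m) + (pairsOfSum ⋆ A) m
      ∎)

  C-fixpoint : ∀ n → C n ≡ δ₀ n + (allowedPart ⋆ C) n
  C-fixpoint zero    = refl
  C-fixpoint (suc m) = trans (count-compositions-suc (allParts? j) m)
    (∑-cong (suc m) (λ p → count-×-dec (allowed? j (suc p)) (allParts? j) (compositions (m ∸ p))))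

  a≡cEven : ∀ n → a n k ≡ cEven j n
  a≡cEven = ⋆-fixpoint-unique {allowedPart} refl A-fixpoint C-fixpoint

open import Data.Integer using (+_; -_)

theorem4p5 : (k : ℤ) (j : ℕ) → k ≡ - (+ (2 * j + 1)) →
    (n : ℕ) → 1 ≤ n → a n k ≡ cEven j n
-- The identity holds for n = 0 as well.
theorem4p5 k j refl n _ = subst (λ m → a n (- (+ m)) ≡ cEven j n) (+-comm 1 (2 * j)) (a≡cEven j n)
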